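{- Let $s$ and $q$ be positive integers with $s = q - 4$ and $s \equiv 3 \pmod 4$. If there exists a skew Hadamard matrix of order $s+1$ and there exists a conference matrix of order $q$, then there exists a Hadamard matrix of order $2q(s+1)$.
   Context: A Hadamard matrix of order $n$ is an $n\times n$ matrix $H$ with entries in $\{ -1,1\}$ such that $HH^T = H^TH = nI_n$. A skew Hadamard matrix is a Hadamard matrix $H$ of the form $H = S + I$ with $S$ skew-symmetric ($S^T=-S$). Write $J_q$ for the $q\times q$ all-ones matrix. In this paper a conference matrix of order $q$ means a $q\times q$ matrix $C_q$ with zero diagonal, entries $\pm 1$ off the diagonal, satisfying $C_qC_q^T = qI_q - J_q$ and $C_qJ_q = J_qC_q = 0$ (for example, for a prime power $q$, the matrix $C_q=[\chi(\alpha_j-\alpha_i)]_{i,j}$ where $\chi$ is the quadratic character of $GF(q)=\{\alpha_1,\dots,\alpha_q\}$ with $\chi(0)=0$). -}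

module Defs where

open import Data.Nat using (ℕ; zero; suc)
open import Data.Integer using (ℤ; +_; -_; _+_; _-_; _*_; 0ℤ; 1ℤ; -1ℤ)
open import Data.Fin using (Fin; zero; suc)
open import Data.Sum using (_⊎_)
open import Data.Product using (_×_)
open import Relation.Binary.PropositionalEquality using (_≡_)
open import Relation.Nullary using (¬_)

Matrix : ℕ → Set
Matrix n = Fin n → Fin n → ℤ

sumFin : (n : ℕ) → (Fin n → ℤ) → ℤ
sumFin zero    f = 0ℤ
sumFin (suc n) f = f zero + sumFin n (λ k → f (suc k))

_⊗_ : {n : ℕ} → Matrix n → Matrix n → Matrix n
_⊗_ {n} A B i j = sumFin n (λ k → A i k * B k j)

transpose : {n : ℕ} → Matrix n → Matrix n
transpose A i j = A j i

δ : {n : ℕ} → Fin n → Fin n → ℤ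
δ zero    zero    = 1ℤ
δ zero    (suc _) = 0ℤ
δ (suc _) zero    = 0ℤ
δ (suc i) (suc j) = δ i j

I : {n : ℕ} → Matrix n
I = δ

J : {n : ℕ} → Matrix n
J _ _ = 1ℤ

_·_ : {n : ℕ} → ℤ → Matrix n → Matrix n
(c · A) i j = c * A i j

_⊕_ : {n : ℕ} → Matrix n → Matrix n → Matrix n
(A ⊕ B) i j = A i j + B i j

_⊖_ : {n : ℕ} → Matrix n → Matrix n → Matrix n
(A ⊖ B) i j = A i j - B i j

negM : {n : ℕ} → Matrix n → Matrix n
negM A i j = - A i j

_≐_ : {n : ℕ} → Matrix n → Matrix n → Set
A ≐ B = ∀ i j → A i j ≡ B i j

IsSign : ℤ → Set
IsSign x = (x ≡ 1ℤ) ⊎ (x ≡ -1ℤ)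

IsHadamard : (n : ℕ) → Matrix n → Set
IsHadamard n H =
  (∀ i j → IsSign (H i j)) ×
  ((H ⊗ transpose H) ≐ ((+ n) · I)) ×
  ((transpose H ⊗ H) ≐ ((+ n) · I))

SkewSymmetric : {n : ℕ} → Matrix n → Set
SkewSymmetric S = transpose S ≐ negM S

IsSkewHadamard : (n : ℕ) → Matrix n → Set
IsSkewHadamard n H =
  IsHadamard n H × SkewSymmetric (H ⊖ I)

IsConference : (q : ℕ) → Matrix q → Set
IsConference q C =
  (∀ i → C i i ≡ 0ℤ) ×
  (∀ i j → ¬ (i ≡ j) → IsSign (C i j)) ×
  ((C ⊗ transpose C) ≐ (((+ q) · I) ⊖ J)) ×
  ((C ⊗ J) ≐ (0ℤ · I)) ×
  ((J ⊗ C) ≐ (0ℤ · I))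

-- Let H be skew Hadamard of order m, S = H − I, Q = H + I, let C be a conference matrix of order q,
-- and put U = C ⊠ S, V = J ⊠ I − I ⊠ Q, where ⊠ is the Kronecker product (⊗ is the matrix product).
-- From SSᵀ = (m − 1)I, QQᵀ = (m + 3)I, Q + Qᵀ = 4I and CCᵀ = qI − J one gets
-- UUᵀ + VVᵀ = (qm − q + m + 3) I + (q − m − 3) J ⊠ I, which is qm I when q = m + 3, and UV = VU because
-- CJ = JC = 0 while S and Q commute. Then X = U − V and Y = U + V satisfy
-- XXᵀ + YYᵀ = XᵀX + YᵀY = 2qm I and XY = YX, so the ±1 matrix [[X, Y], [−Yᵀ, Xᵀ]] of order 2qm
-- is Hadamard. The transposed identities come from the same computation for (Cᵀ, Hᵀ). Over ℤ,
-- MMᵀ = cI forces MᵀM = cI: D = MᵀM − cI has DMᵀ = 0, so D² = −cD, tr D = 0 and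
-- Σ D²ᵢⱼ = tr (D Dᵀ) = 0.

module Submission where

open import Defs

-- Integer arithmetic is opened only inside this module, so that + and * in theorem3p4 stay those of ℕ.
module _ where

  open import Data.Nat as ℕ using (ℕ; zero; suc; z≤n)
  open import Data.Integer using (ℤ; +_; -[1+_]; -_; _≤_; +≤+; _+_; _-_; _*_; 0ℤ; 1ℤ; -1ℤ)
  open import Data.Integer.Properties
    using (+-*-semiring; +-assoc; +-comm; +-identityˡ; +-identityʳ; +-inverseˡ; +-inverseʳ;
           *-assoc; *-comm; *-identityˡ; *-identityʳ; *-zeroˡ; *-zeroʳ; *-distribˡ-+; *-distribʳ-+;
           neg-involutive; neg-distribˡ-*; neg-distribʳ-*; -1*i≡-i; i-j≡0⇒i≡j; i*j≡0⇒i≡0∨j≡0; pos-+; pos-*;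
           ≤-refl; ≤-antisym; +-mono-≤; +-monoʳ-≤)
  open import Data.Integer.Tactic.RingSolver using (solve-∀)
  open import Data.Fin using (Fin; zero; suc; _↑ˡ_; _↑ʳ_; combine; quotient; remainder; _≟_)
  open import Data.Fin.Properties using (remQuot-combine; combine-remQuot; combine-injectiveˡ; combine-injectiveʳ)
  open import Data.Product using (_,_; proj₁; proj₂)
  open import Relation.Nullary using (¬_; contradiction; yes; no)
  open import Function using (_∘_; id)
  open import Data.Sum using ([_,_]′; inj₁; inj₂)
  open import Relation.Binary.PropositionalEquality using (_≡_; refl; sym; trans; cong; cong₂; subst; subst₂; module ≡-Reasoning)
  open ≡-Reasoning
  open import Algebra.Properties.Semiring.Sum +-*-semiring
    using (sum; sum-syntax; sum-cong-≗; ∑-distrib-+; ∑-comm; sum-replicate-zero; *-distribˡ-sum; *-distribʳ-sum)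

  sumFin≡sum : ∀ n (f : Fin n → ℤ) → sumFin n f ≡ sum f
  sumFin≡sum zero    f = refl
  sumFin≡sum (suc n) f = cong (λ s → f zero + s) (sumFin≡sum n (λ k → f (suc k)))

  ∑-linear : ∀ {n} (a b : ℤ) (f g : Fin n → ℤ) →
             ∑[ k < n ] (a * f k + b * g k) ≡ a * sum f + b * sum g
  ∑-linear a b f g = begin
    ∑[ k < _ ] (a * f k + b * g k)              ≡⟨ ∑-distrib-+ (λ k → a * f k) (λ k → b * g k) ⟩
    ∑[ k < _ ] (a * f k) + ∑[ k < _ ] (b * g k) ≡⟨ sym (cong₂ _+_ (*-distribˡ-sum a f) (*-distribˡ-sum b g)) ⟩
    a * sum f + b * sum g                         ∎

  ∑-neg : ∀ {n} (f : Fin n → ℤ) → ∑[ k < n ] (- f k) ≡ - sum f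
  ∑-neg f = begin
    ∑[ k < _ ] (- f k)       ≡⟨ sum-cong-≗ (λ k → sym (-1*i≡-i (f k))) ⟩
    ∑[ k < _ ] (-1ℤ * f k)   ≡⟨ sym (*-distribˡ-sum -1ℤ f) ⟩
    -1ℤ * sum f              ≡⟨ -1*i≡-i (sum f) ⟩
    - sum f                  ∎

  ∑-distrib-- : ∀ {n} (f g : Fin n → ℤ) → ∑[ k < n ] (f k - g k) ≡ sum f - sum g
  ∑-distrib-- f g = trans (∑-distrib-+ f (λ k → - g k)) (cong (λ s → sum f + s) (∑-neg g))

  ∑-↑ : ∀ m n (f : Fin (m ℕ.+ n) → ℤ) → sum f ≡ ∑[ i < m ] f (i ↑ˡ n) + ∑[ j < n ] f (m ↑ʳ j)
  ∑-↑ zero    n f = sym (+-identityˡ (sum f))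
  ∑-↑ (suc m) n f = begin
    f zero + sum (f ∘ suc)                                              ≡⟨ cong (λ s → f zero + s) (∑-↑ m n (f ∘ suc)) ⟩
    f zero + (∑[ i < m ] f (suc (i ↑ˡ n)) + ∑[ j < n ] f (suc (m ↑ʳ j))) ≡⟨ sym (+-assoc (f zero) _ _) ⟩
    f zero + ∑[ i < m ] f (suc (i ↑ˡ n)) + ∑[ j < n ] f (suc (m ↑ʳ j))   ∎

  ∑-combine : ∀ m n (f : Fin (m ℕ.* n) → ℤ) → sum f ≡ ∑[ x < m ] ∑[ i < n ] f (combine x i)
  ∑-combine zero    n f = refl
  ∑-combine (suc m) n f = begin
    sum f                                                          ≡⟨ ∑-↑ n (m ℕ.* n) f ⟩
    ∑[ i < n ] f (i ↑ˡ m ℕ.* n) + ∑[ r < m ℕ.* n ] f (n ↑ʳ r)      ≡⟨ cong (λ s → ∑[ i < n ] f (i ↑ˡ m ℕ.* n) + s) (∑-combine m n (λ r → f (n ↑ʳ r))) ⟩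
    ∑[ i < n ] f (i ↑ˡ m ℕ.* n) + ∑[ x < m ] ∑[ i < n ] f (n ↑ʳ combine x i) ∎

  ∑-one : ∀ n → ∑[ k < n ] 1ℤ ≡ + n
  ∑-one zero    = refl
  ∑-one (suc n) = cong (λ s → 1ℤ + s) (∑-one n)

  square-nonneg : ∀ x → 0ℤ ≤ x * x
  square-nonneg (+ n)    = subst (0ℤ ≤_) (pos-* n n) (+≤+ z≤n)
  square-nonneg -[1+ n ] = +≤+ z≤n

  square≡0 : ∀ x → x * x ≡ 0ℤ → x ≡ 0ℤ
  square≡0 x x²≡0 = [ id , id ]′ (i*j≡0⇒i≡0∨j≡0 x x²≡0)

  ∑-nonneg : ∀ {n} (f : Fin n → ℤ) → (∀ k → 0ℤ ≤ f k) → 0ℤ ≤ sum f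
  ∑-nonneg {zero}  f f≥0 = ≤-refl
  ∑-nonneg {suc n} f f≥0 = +-mono-≤ (f≥0 zero) (∑-nonneg (f ∘ suc) (f≥0 ∘ suc))

  nonneg-+≡0⇒≡0 : ∀ {x y} → 0ℤ ≤ x → 0ℤ ≤ y → x + y ≡ 0ℤ → x ≡ 0ℤ
  nonneg-+≡0⇒≡0 {x} {y} 0≤x 0≤y x+y≡0 = ≤-antisym (subst (x ≤_) x+y≡0 x≤x+y) 0≤x
    where
    x≤x+y : x ≤ x + y
    x≤x+y = subst (_≤ x + y) (+-identityʳ x) (+-monoʳ-≤ x 0≤y)

  ∑-nonneg-≡0 : ∀ {n} (f : Fin n → ℤ) → (∀ k → 0ℤ ≤ f k) → sum f ≡ 0ℤ → ∀ k → f k ≡ 0ℤ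
  ∑-nonneg-≡0 f f≥0 ∑f≡0 zero =
    nonneg-+≡0⇒≡0 (f≥0 zero) (∑-nonneg (f ∘ suc) (f≥0 ∘ suc)) ∑f≡0
  ∑-nonneg-≡0 f f≥0 ∑f≡0 (suc k) = ∑-nonneg-≡0 (f ∘ suc) (f≥0 ∘ suc)
    (nonneg-+≡0⇒≡0 (∑-nonneg (f ∘ suc) (f≥0 ∘ suc)) (f≥0 zero) (trans (+-comm (sum (f ∘ suc)) (f zero)) ∑f≡0)) k

  δ-refl : ∀ {n} (i : Fin n) → δ i i ≡ 1ℤ
  δ-refl zero    = refl
  δ-refl (suc i) = δ-refl i

  δ-≢ : ∀ {n} {i j : Fin n} → ¬ i ≡ j → δ i j ≡ 0ℤ
  δ-≢ {i = zero}  {zero}  i≢j = contradiction refl i≢j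
  δ-≢ {i = zero}  {suc j} i≢j = refl
  δ-≢ {i = suc i} {zero}  i≢j = refl
  δ-≢ {i = suc i} {suc j} i≢j = δ-≢ (i≢j ∘ cong suc)

  δ-sym : ∀ {n} (i j : Fin n) → δ i j ≡ δ j i
  δ-sym zero    zero    = refl
  δ-sym zero    (suc j) = refl
  δ-sym (suc i) zero    = refl
  δ-sym (suc i) (suc j) = δ-sym i j

  ∑-δˡ : ∀ {n} (i : Fin n) (f : Fin n → ℤ) → ∑[ k < n ] (δ i k * f k) ≡ f i
  ∑-δˡ {suc n} zero f = begin
    1ℤ * f zero + ∑[ k < n ] (0ℤ * f (suc k)) ≡⟨ cong₂ _+_ (*-identityˡ (f zero)) (sum-cong-≗ (λ k → *-zeroˡ (f (suc k)))) ⟩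
    f zero + ∑[ k < n ] 0ℤ                    ≡⟨ cong (λ s → f zero + s) (sum-replicate-zero n) ⟩
    f zero + 0ℤ                               ≡⟨ +-identityʳ (f zero) ⟩
    f zero                                    ∎
  ∑-δˡ {suc n} (suc i) f = begin
    0ℤ * f zero + ∑[ k < n ] (δ i k * f (suc k)) ≡⟨ cong (_+ ∑[ k < n ] (δ i k * f (suc k))) (*-zeroˡ (f zero)) ⟩
    0ℤ + ∑[ k < n ] (δ i k * f (suc k))          ≡⟨ +-identityˡ _ ⟩
    ∑[ k < n ] (δ i k * f (suc k))               ≡⟨ ∑-δˡ i (f ∘ suc) ⟩
    f (suc i)                                    ∎

  δ-combine : ∀ {m n} (x y : Fin m) (i j : Fin n) → δ (combine x i) (combine y j) ≡ δ x y * δ i j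
  δ-combine x y i j with x ≟ y | i ≟ j
  ... | yes refl | yes refl = begin
    δ (combine x i) (combine x i) ≡⟨ δ-refl (combine x i) ⟩
    1ℤ                            ≡⟨ sym (cong₂ _*_ (δ-refl x) (δ-refl i)) ⟩
    δ x x * δ i i                 ∎
  ... | no x≢y | _ = begin
    δ (combine x i) (combine y j) ≡⟨ δ-≢ (x≢y ∘ combine-injectiveˡ x i y j) ⟩
    0ℤ                            ≡⟨ sym (trans (cong (_* δ i j) (δ-≢ x≢y)) (*-zeroˡ (δ i j))) ⟩
    δ x y * δ i j                 ∎
  ... | yes refl | no i≢j = begin
    δ (combine x i) (combine x j) ≡⟨ δ-≢ (i≢j ∘ combine-injectiveʳ x i x j) ⟩
    0ℤ                            ≡⟨ sym (trans (cong (δ x x *_) (δ-≢ i≢j)) (*-zeroʳ (δ x x))) ⟩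
    δ x x * δ i j                 ∎

  module _ {n : ℕ} where

    ⊗-sum : (A B : Matrix n) (i j : Fin n) → (A ⊗ B) i j ≡ ∑[ k < n ] (A i k * B k j)
    ⊗-sum A B i j = sumFin≡sum n _

    ⊗-cong : {A A′ B B′ : Matrix n} → A ≐ A′ → B ≐ B′ → (A ⊗ B) ≐ (A′ ⊗ B′)
    ⊗-cong {A} {A′} {B} {B′} A≐A′ B≐B′ i j = begin
      (A ⊗ B) i j                   ≡⟨ ⊗-sum A B i j ⟩
      ∑[ k < n ] (A i k * B k j)    ≡⟨ sum-cong-≗ (λ k → cong₂ _*_ (A≐A′ i k) (B≐B′ k j)) ⟩
      ∑[ k < n ] (A′ i k * B′ k j)  ≡⟨ sym (⊗-sum A′ B′ i j) ⟩
      (A′ ⊗ B′) i j                 ∎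

    ⊗-congʳ : (A : Matrix n) {B B′ : Matrix n} → B ≐ B′ → (A ⊗ B) ≐ (A ⊗ B′)
    ⊗-congʳ A = ⊗-cong {A = A} (λ _ _ → refl)

    ⊗-identityˡ : (A : Matrix n) → (I ⊗ A) ≐ A
    ⊗-identityˡ A i j = trans (⊗-sum I A i j) (∑-δˡ i (λ k → A k j))

    ⊗-identityʳ : (A : Matrix n) → (A ⊗ I) ≐ A
    ⊗-identityʳ A i j = begin
      (A ⊗ I) i j                 ≡⟨ ⊗-sum A I i j ⟩
      ∑[ k < n ] (A i k * δ k j)  ≡⟨ sum-cong-≗ (λ k → trans (*-comm (A i k) (δ k j)) (cong (_* A i k) (δ-sym k j))) ⟩
      ∑[ k < n ] (δ j k * A i k)  ≡⟨ ∑-δˡ j (A i) ⟩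
      A i j                       ∎

    ⊗-scalarˡ : (c : ℤ) (A B : Matrix n) → ((c · A) ⊗ B) ≐ (c · (A ⊗ B))
    ⊗-scalarˡ c A B i j = begin
      ((c · A) ⊗ B) i j               ≡⟨ ⊗-sum (c · A) B i j ⟩
      ∑[ k < n ] (c * A i k * B k j)  ≡⟨ sum-cong-≗ (λ k → *-assoc c (A i k) (B k j)) ⟩
      ∑[ k < n ] (c * (A i k * B k j)) ≡⟨ sym (*-distribˡ-sum c (λ k → A i k * B k j)) ⟩
      c * ∑[ k < n ] (A i k * B k j)  ≡⟨ cong (c *_) (sym (⊗-sum A B i j)) ⟩
      c * (A ⊗ B) i j                 ∎

    ⊗-scalarʳ : (c : ℤ) (A B : Matrix n) → (A ⊗ (c · B)) ≐ (c · (A ⊗ B))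
    ⊗-scalarʳ c A B i j = begin
      (A ⊗ (c · B)) i j                ≡⟨ ⊗-sum A (c · B) i j ⟩
      ∑[ k < n ] (A i k * (c * B k j)) ≡⟨ sum-cong-≗ (λ k → swap (A i k) c (B k j)) ⟩
      ∑[ k < n ] (c * (A i k * B k j)) ≡⟨ sym (*-distribˡ-sum c (λ k → A i k * B k j)) ⟩
      c * ∑[ k < n ] (A i k * B k j)   ≡⟨ cong (c *_) (sym (⊗-sum A B i j)) ⟩
      c * (A ⊗ B) i j                  ∎
      where
      swap : ∀ a c b → a * (c * b) ≡ c * (a * b)
      swap = solve-∀

    ⊗-distribˡ-⊕ : (A B C : Matrix n) → (A ⊗ (B ⊕ C)) ≐ ((A ⊗ B) ⊕ (A ⊗ C))
    ⊗-distribˡ-⊕ A B C i j = begin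
      (A ⊗ (B ⊕ C)) i j                                        ≡⟨ ⊗-sum A (B ⊕ C) i j ⟩
      ∑[ k < n ] (A i k * (B k j + C k j))                     ≡⟨ sum-cong-≗ (λ k → *-distribˡ-+ (A i k) (B k j) (C k j)) ⟩
      ∑[ k < n ] (A i k * B k j + A i k * C k j)               ≡⟨ ∑-distrib-+ (λ k → A i k * B k j) (λ k → A i k * C k j) ⟩
      ∑[ k < n ] (A i k * B k j) + ∑[ k < n ] (A i k * C k j)  ≡⟨ sym (cong₂ _+_ (⊗-sum A B i j) (⊗-sum A C i j)) ⟩
      (A ⊗ B) i j + (A ⊗ C) i j                                ∎

    ⊗-distribʳ-⊕ : (A B C : Matrix n) → ((A ⊕ B) ⊗ C) ≐ ((A ⊗ C) ⊕ (B ⊗ C))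
    ⊗-distribʳ-⊕ A B C i j = begin
      ((A ⊕ B) ⊗ C) i j                                        ≡⟨ ⊗-sum (A ⊕ B) C i j ⟩
      ∑[ k < n ] ((A i k + B i k) * C k j)                     ≡⟨ sum-cong-≗ (λ k → *-distribʳ-+ (C k j) (A i k) (B i k)) ⟩
      ∑[ k < n ] (A i k * C k j + B i k * C k j)               ≡⟨ ∑-distrib-+ (λ k → A i k * C k j) (λ k → B i k * C k j) ⟩
      ∑[ k < n ] (A i k * C k j) + ∑[ k < n ] (B i k * C k j)  ≡⟨ sym (cong₂ _+_ (⊗-sum A C i j) (⊗-sum B C i j)) ⟩
      (A ⊗ C) i j + (B ⊗ C) i j                                ∎

    ⊗-distribˡ-⊖ : (A B C : Matrix n) → (A ⊗ (B ⊖ C)) ≐ ((A ⊗ B) ⊖ (A ⊗ C))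
    ⊗-distribˡ-⊖ A B C i j = begin
      (A ⊗ (B ⊖ C)) i j                                        ≡⟨ ⊗-sum A (B ⊖ C) i j ⟩
      ∑[ k < n ] (A i k * (B k j - C k j))                     ≡⟨ sum-cong-≗ (λ k → distrib (A i k) (B k j) (C k j)) ⟩
      ∑[ k < n ] (A i k * B k j - A i k * C k j)               ≡⟨ ∑-distrib-- (λ k → A i k * B k j) (λ k → A i k * C k j) ⟩
      ∑[ k < n ] (A i k * B k j) - ∑[ k < n ] (A i k * C k j)  ≡⟨ sym (cong₂ _-_ (⊗-sum A B i j) (⊗-sum A C i j)) ⟩
      (A ⊗ B) i j - (A ⊗ C) i j                                ∎
      where
      distrib : ∀ a b c → a * (b - c) ≡ a * b - a * c
      distrib = solve-∀

    ⊗-distribʳ-⊖ : (A B C : Matrix n) → ((A ⊖ B) ⊗ C) ≐ ((A ⊗ C) ⊖ (B ⊗ C))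
    ⊗-distribʳ-⊖ A B C i j = begin
      ((A ⊖ B) ⊗ C) i j                                        ≡⟨ ⊗-sum (A ⊖ B) C i j ⟩
      ∑[ k < n ] ((A i k - B i k) * C k j)                     ≡⟨ sum-cong-≗ (λ k → distrib (A i k) (B i k) (C k j)) ⟩
      ∑[ k < n ] (A i k * C k j - B i k * C k j)               ≡⟨ ∑-distrib-- (λ k → A i k * C k j) (λ k → B i k * C k j) ⟩
      ∑[ k < n ] (A i k * C k j) - ∑[ k < n ] (B i k * C k j)  ≡⟨ sym (cong₂ _-_ (⊗-sum A C i j) (⊗-sum B C i j)) ⟩
      (A ⊗ C) i j - (B ⊗ C) i j                                ∎
      where
      distrib : ∀ a b c → (a - b) * c ≡ a * c - b * c
      distrib = solve-∀

    transpose-⊗ : (A B : Matrix n) → (transpose A ⊗ transpose B) ≐ transpose (B ⊗ A)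
    transpose-⊗ A B i j = begin
      (transpose A ⊗ transpose B) i j ≡⟨ ⊗-sum (transpose A) (transpose B) i j ⟩
      ∑[ k < n ] (A k i * B j k)       ≡⟨ sum-cong-≗ (λ k → *-comm (A k i) (B j k)) ⟩
      ∑[ k < n ] (B j k * A k i)       ≡⟨ sym (⊗-sum B A j i) ⟩
      (B ⊗ A) j i                      ∎

    ⊗-negˡ : (A B : Matrix n) → (negM A ⊗ B) ≐ negM (A ⊗ B)
    ⊗-negˡ A B i j = begin
      (negM A ⊗ B) i j                 ≡⟨ ⊗-sum (negM A) B i j ⟩
      ∑[ k < n ] (- A i k * B k j)     ≡⟨ sum-cong-≗ (λ k → sym (neg-distribˡ-* (A i k) (B k j))) ⟩
      ∑[ k < n ] (- (A i k * B k j))   ≡⟨ ∑-neg (λ k → A i k * B k j) ⟩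
      - ∑[ k < n ] (A i k * B k j)     ≡⟨ cong -_ (sym (⊗-sum A B i j)) ⟩
      - (A ⊗ B) i j                    ∎

    ⊗-negʳ : (A B : Matrix n) → (A ⊗ negM B) ≐ negM (A ⊗ B)
    ⊗-negʳ A B i j = begin
      (A ⊗ negM B) i j                 ≡⟨ ⊗-sum A (negM B) i j ⟩
      ∑[ k < n ] (A i k * - B k j)     ≡⟨ sum-cong-≗ (λ k → sym (neg-distribʳ-* (A i k) (B k j))) ⟩
      ∑[ k < n ] (- (A i k * B k j))   ≡⟨ ∑-neg (λ k → A i k * B k j) ⟩
      - ∑[ k < n ] (A i k * B k j)     ≡⟨ cong -_ (sym (⊗-sum A B i j)) ⟩
      - (A ⊗ B) i j                    ∎

    ⊗-assoc : (A B C : Matrix n) → ((A ⊗ B) ⊗ C) ≐ (A ⊗ (B ⊗ C))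
    ⊗-assoc A B C i j = begin
      ((A ⊗ B) ⊗ C) i j                                       ≡⟨ ⊗-sum (A ⊗ B) C i j ⟩
      ∑[ l < n ] ((A ⊗ B) i l * C l j)                        ≡⟨ sum-cong-≗ (λ l → begin
          (A ⊗ B) i l * C l j                       ≡⟨ cong (_* C l j) (⊗-sum A B i l) ⟩
          ∑[ k < n ] (A i k * B k l) * C l j        ≡⟨ *-distribʳ-sum (C l j) (λ k → A i k * B k l) ⟩
          ∑[ k < n ] (A i k * B k l * C l j)        ≡⟨ sum-cong-≗ (λ k → *-assoc (A i k) (B k l) (C l j)) ⟩
          ∑[ k < n ] (A i k * (B k l * C l j))      ∎) ⟩
      ∑[ l < n ] ∑[ k < n ] (A i k * (B k l * C l j))          ≡⟨ ∑-comm (λ l k → A i k * (B k l * C l j)) ⟩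
      ∑[ k < n ] ∑[ l < n ] (A i k * (B k l * C l j))          ≡⟨ sum-cong-≗ (λ k → begin
          ∑[ l < n ] (A i k * (B k l * C l j))      ≡⟨ sym (*-distribˡ-sum (A i k) (λ l → B k l * C l j)) ⟩
          A i k * ∑[ l < n ] (B k l * C l j)        ≡⟨ cong (A i k *_) (sym (⊗-sum B C k j)) ⟩
          A i k * (B ⊗ C) k j                       ∎) ⟩
      ∑[ k < n ] (A i k * (B ⊗ C) k j)                         ≡⟨ sym (⊗-sum A (B ⊗ C) i j) ⟩
      (A ⊗ (B ⊗ C)) i j                                        ∎

    scalarI-⊗ : (c : ℤ) (A : Matrix n) → ((c · I) ⊗ A) ≐ (c · A)
    scalarI-⊗ c A i j = trans (⊗-scalarˡ c I A i j) (cong (c *_) (⊗-identityˡ A i j))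

    ⊗-scalarI : (c : ℤ) (A : Matrix n) → (A ⊗ (c · I)) ≐ (c · A)
    ⊗-scalarI c A i j = trans (⊗-scalarʳ c A I i j) (cong (c *_) (⊗-identityʳ A i j))

    transpose-I : transpose I ≐ I {n}
    transpose-I i j = δ-sym j i

    ⊗-transpose-I : (A : Matrix n) → (A ⊗ transpose I) ≐ A
    ⊗-transpose-I A i j = trans (⊗-congʳ A transpose-I i j) (⊗-identityʳ A i j)

    J⊗J≡n : (i j : Fin n) → (J ⊗ J) i j ≡ + n
    J⊗J≡n i j = trans (⊗-sum J J i j) (∑-one n)

    ⊗-zeroˡ : {Z : Matrix n} (A : Matrix n) → (∀ i j → Z i j ≡ 0ℤ) → ∀ i j → (Z ⊗ A) i j ≡ 0ℤ
    ⊗-zeroˡ {Z} A Z≡0 i j = begin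
      (Z ⊗ A) i j                 ≡⟨ ⊗-sum Z A i j ⟩
      ∑[ k < n ] (Z i k * A k j)  ≡⟨ sum-cong-≗ (λ k → trans (cong (_* A k j) (Z≡0 i k)) (*-zeroˡ (A k j))) ⟩
      ∑[ k < n ] 0ℤ               ≡⟨ sum-replicate-zero n ⟩
      0ℤ                          ∎

    trace-⊗-transpose : (A : Matrix n) → ∑[ i < n ] (transpose A ⊗ A) i i ≡ ∑[ i < n ] (A ⊗ transpose A) i i
    trace-⊗-transpose A = begin
      ∑[ i < n ] (transpose A ⊗ A) i i       ≡⟨ sum-cong-≗ (λ i → ⊗-sum (transpose A) A i i) ⟩
      ∑[ i < n ] ∑[ k < n ] (A k i * A k i)  ≡⟨ ∑-comm (λ i k → A k i * A k i) ⟩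
      ∑[ k < n ] ∑[ i < n ] (A k i * A k i)  ≡⟨ sym (sum-cong-≗ (λ k → ⊗-sum A (transpose A) k k)) ⟩
      ∑[ k < n ] (A ⊗ transpose A) k k       ∎

  -- One-sided orthogonality suffices over ℤ

  module _ {n : ℕ} (c : ℤ) (M : Matrix n) (MMᵀ≐cI : (M ⊗ transpose M) ≐ (c · I)) where

    private
      Mᵀ D : Matrix n
      Mᵀ = transpose M
      D = (Mᵀ ⊗ M) ⊖ (c · I)

      D-sym : ∀ i j → D i j ≡ D j i
      D-sym i j = cong₂ (λ x y → x - c * y) (transpose-⊗ M Mᵀ i j) (δ-sym i j)

      DMᵀ≡0 : ∀ i j → (D ⊗ Mᵀ) i j ≡ 0ℤ
      DMᵀ≡0 i j = begin
        (D ⊗ Mᵀ) i j                                  ≡⟨ ⊗-distribʳ-⊖ (Mᵀ ⊗ M) (c · I) Mᵀ i j ⟩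
        ((Mᵀ ⊗ M) ⊗ Mᵀ) i j - ((c · I) ⊗ Mᵀ) i j      ≡⟨ cong₂ _-_ (⊗-assoc Mᵀ M Mᵀ i j) (scalarI-⊗ c Mᵀ i j) ⟩
        (Mᵀ ⊗ (M ⊗ Mᵀ)) i j - c * Mᵀ i j               ≡⟨ cong (_- c * Mᵀ i j) (⊗-congʳ Mᵀ MMᵀ≐cI i j) ⟩
        (Mᵀ ⊗ (c · I)) i j - c * Mᵀ i j                ≡⟨ cong (_- c * Mᵀ i j) (⊗-scalarI c Mᵀ i j) ⟩
        c * Mᵀ i j - c * Mᵀ i j                        ≡⟨ +-inverseʳ (c * Mᵀ i j) ⟩
        0ℤ                                             ∎

      D²≡-cD : ∀ i j → (D ⊗ D) i j ≡ - (c * D i j)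
      D²≡-cD i j = begin
        (D ⊗ D) i j                                    ≡⟨ ⊗-distribˡ-⊖ D (Mᵀ ⊗ M) (c · I) i j ⟩
        (D ⊗ (Mᵀ ⊗ M)) i j - (D ⊗ (c · I)) i j         ≡⟨ cong₂ _-_ (sym (⊗-assoc D Mᵀ M i j)) (⊗-scalarI c D i j) ⟩
        ((D ⊗ Mᵀ) ⊗ M) i j - c * D i j                 ≡⟨ cong (_- c * D i j) (⊗-zeroˡ M DMᵀ≡0 i j) ⟩
        0ℤ - c * D i j                                 ≡⟨ +-identityˡ _ ⟩
        - (c * D i j)                                  ∎

      trace-D≡0 : ∑[ i < n ] D i i ≡ 0ℤ
      trace-D≡0 = begin
        ∑[ i < n ] D i i                                              ≡⟨ ∑-distrib-- (λ i → (Mᵀ ⊗ M) i i) (λ i → c * δ i i) ⟩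
        ∑[ i < n ] (Mᵀ ⊗ M) i i - ∑[ i < n ] (c * δ i i)              ≡⟨ cong (_- ∑[ i < n ] (c * δ i i)) (trace-⊗-transpose M) ⟩
        ∑[ i < n ] (M ⊗ Mᵀ) i i - ∑[ i < n ] (c * δ i i)              ≡⟨ cong (_- ∑[ i < n ] (c * δ i i)) (sum-cong-≗ (λ i → MMᵀ≐cI i i)) ⟩
        ∑[ i < n ] (c * δ i i) - ∑[ i < n ] (c * δ i i)               ≡⟨ +-inverseʳ (∑[ i < n ] (c * δ i i)) ⟩
        0ℤ                                                            ∎

      ∑D²≡0 : ∑[ i < n ] ∑[ j < n ] (D i j * D i j) ≡ 0ℤ
      ∑D²≡0 = begin
        ∑[ i < n ] ∑[ j < n ] (D i j * D i j)  ≡⟨ sum-cong-≗ (λ i → sum-cong-≗ (λ j → cong (D i j *_) (D-sym i j))) ⟩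
        ∑[ i < n ] ∑[ j < n ] (D i j * D j i)  ≡⟨ sym (sum-cong-≗ (λ i → ⊗-sum D D i i)) ⟩
        ∑[ i < n ] (D ⊗ D) i i                 ≡⟨ sum-cong-≗ (λ i → D²≡-cD i i) ⟩
        ∑[ i < n ] (- (c * D i i))             ≡⟨ ∑-neg (λ i → c * D i i) ⟩
        - ∑[ i < n ] (c * D i i)               ≡⟨ cong -_ (sym (*-distribˡ-sum c (λ i → D i i))) ⟩
        - (c * ∑[ i < n ] D i i)               ≡⟨ cong (λ t → - (c * t)) trace-D≡0 ⟩
        - (c * 0ℤ)                             ≡⟨ cong -_ (*-zeroʳ c) ⟩
        0ℤ                                     ∎

      ∑ⱼD²≡0 : ∀ i → ∑[ j < n ] (D i j * D i j) ≡ 0ℤ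
      ∑ⱼD²≡0 = ∑-nonneg-≡0 (λ i → ∑[ j < n ] (D i j * D i j))
                 (λ i → ∑-nonneg (λ j → D i j * D i j) (λ j → square-nonneg (D i j))) ∑D²≡0

      D≡0 : ∀ i j → D i j ≡ 0ℤ
      D≡0 i j = square≡0 (D i j) (∑-nonneg-≡0 (λ j → D i j * D i j) (λ j → square-nonneg (D i j)) (∑ⱼD²≡0 i) j)

    MMᵀ≐cI⇒MᵀM≐cI : (transpose M ⊗ M) ≐ (c · I)
    MMᵀ≐cI⇒MᵀM≐cI i j = i-j≡0⇒i≡j _ _ (D≡0 i j)

  -- Block matrices and Kronecker products

  blocks : ∀ {m n} → (Fin m → Fin m → Matrix n) → Matrix (m ℕ.* n)
  blocks {m} {n} B a b = B (quotient n a) (quotient n b) (remainder {m} n a) (remainder {m} n b)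

  _⊠_ : ∀ {m n} → Matrix m → Matrix n → Matrix (m ℕ.* n)
  A ⊠ B = blocks (λ x y → A x y · B)

  module _ {m n : ℕ} where

    blocks-combine : (B : Fin m → Fin m → Matrix n) (x y : Fin m) (i j : Fin n) →
                     blocks B (combine x i) (combine y j) ≡ B x y i j
    blocks-combine B x y i j =
      cong₂ (λ p p′ → B (proj₁ p) (proj₁ p′) (proj₂ p) (proj₂ p′)) (remQuot-combine x i) (remQuot-combine y j)

    ≐-combine : {P Q : Matrix (m ℕ.* n)} →
                (∀ (x y : Fin m) (i j : Fin n) → P (combine x i) (combine y j) ≡ Q (combine x i) (combine y j)) → P ≐ Q
    ≐-combine {P} {Q} eq a b =
      subst₂ (λ a′ b′ → P a′ b′ ≡ Q a′ b′) (combine-remQuot {m} n a) (combine-remQuot {m} n b) (eq _ _ _ _)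

    blocks-⊗ : (B B′ : Fin m → Fin m → Matrix n) (x z : Fin m) (i l : Fin n) →
               (blocks B ⊗ blocks B′) (combine x i) (combine z l) ≡ ∑[ y < m ] (B x y ⊗ B′ y z) i l
    blocks-⊗ B B′ x z i l = begin
      (blocks B ⊗ blocks B′) (combine x i) (combine z l)                      ≡⟨ ⊗-sum (blocks B) (blocks B′) _ _ ⟩
      ∑[ a < m ℕ.* n ] (blocks B (combine x i) a * blocks B′ a (combine z l))  ≡⟨ ∑-combine m n (λ a → blocks B (combine x i) a * blocks B′ a (combine z l)) ⟩
      ∑[ y < m ] ∑[ j < n ] (blocks B (combine x i) (combine y j) * blocks B′ (combine y j) (combine z l))
        ≡⟨ sum-cong-≗ (λ y → sum-cong-≗ (λ j → cong₂ _*_ (blocks-combine B x y i j) (blocks-combine B′ y z j l))) ⟩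
      ∑[ y < m ] ∑[ j < n ] (B x y i j * B′ y z j l)                          ≡⟨ sym (sum-cong-≗ (λ y → ⊗-sum (B x y) (B′ y z) i l)) ⟩
      ∑[ y < m ] (B x y ⊗ B′ y z) i l                                         ∎

    ⊠-⊗ : (A C : Matrix m) (B D : Matrix n) → ((A ⊠ B) ⊗ (C ⊠ D)) ≐ ((A ⊗ C) ⊠ (B ⊗ D))
    ⊠-⊗ A C B D = ≐-combine entry
      where
      scaled : ∀ x y z i l → ((A x y · B) ⊗ (C y z · D)) i l ≡ A x y * C y z * (B ⊗ D) i l
      scaled x y z i l = begin
        ((A x y · B) ⊗ (C y z · D)) i l     ≡⟨ ⊗-scalarˡ (A x y) B (C y z · D) i l ⟩
        A x y * (B ⊗ (C y z · D)) i l       ≡⟨ cong (A x y *_) (⊗-scalarʳ (C y z) B D i l) ⟩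
        A x y * (C y z * (B ⊗ D) i l)       ≡⟨ sym (*-assoc (A x y) (C y z) ((B ⊗ D) i l)) ⟩
        A x y * C y z * (B ⊗ D) i l         ∎

      entry : ∀ x z i l → ((A ⊠ B) ⊗ (C ⊠ D)) (combine x i) (combine z l) ≡ ((A ⊗ C) ⊠ (B ⊗ D)) (combine x i) (combine z l)
      entry x z i l = begin
        ((A ⊠ B) ⊗ (C ⊠ D)) (combine x i) (combine z l)      ≡⟨ blocks-⊗ (λ x y → A x y · B) (λ y z → C y z · D) x z i l ⟩
        ∑[ y < m ] ((A x y · B) ⊗ (C y z · D)) i l           ≡⟨ sum-cong-≗ (λ y → scaled x y z i l) ⟩
        ∑[ y < m ] (A x y * C y z * (B ⊗ D) i l)             ≡⟨ sym (*-distribʳ-sum ((B ⊗ D) i l) (λ y → A x y * C y z)) ⟩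
        ∑[ y < m ] (A x y * C y z) * (B ⊗ D) i l             ≡⟨ cong (_* (B ⊗ D) i l) (sym (⊗-sum A C x z)) ⟩
        (A ⊗ C) x z * (B ⊗ D) i l                            ≡⟨ sym (blocks-combine (λ x y → (A ⊗ C) x y · (B ⊗ D)) x z i l) ⟩
        ((A ⊗ C) ⊠ (B ⊗ D)) (combine x i) (combine z l)      ∎

    ⊠-⊗-combine : (A C : Matrix m) (B D : Matrix n) (i j : Fin m) (u v : Fin n) →
                  ((A ⊠ B) ⊗ (C ⊠ D)) (combine i u) (combine j v) ≡ (A ⊗ C) i j * (B ⊗ D) u v
    ⊠-⊗-combine A C B D i j u v =
      trans (⊠-⊗ A C B D (combine i u) (combine j v)) (blocks-combine (λ x y → (A ⊗ C) x y · (B ⊗ D)) i j u v)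

  -- The two-block construction

  quadrants : ∀ {n} → Matrix n → Matrix n → Fin 2 → Fin 2 → Matrix n
  quadrants X Y zero       zero       = X
  quadrants X Y zero       (suc zero) = Y
  quadrants X Y (suc zero) zero       = negM (transpose Y)
  quadrants X Y (suc zero) (suc zero) = transpose X

  twoBlock : ∀ {n} → Matrix n → Matrix n → Matrix (2 ℕ.* n)
  twoBlock X Y = blocks (quadrants X Y)

  module _ {n : ℕ} (k : ℤ) (X Y : Matrix n)
           (XXᵀ+YYᵀ≐kI : ((X ⊗ transpose X) ⊕ (Y ⊗ transpose Y)) ≐ (k · I))
           (XᵀX+YᵀY≐kI : ((transpose X ⊗ X) ⊕ (transpose Y ⊗ Y)) ≐ (k · I))
           (XY≐YX : (X ⊗ Y) ≐ (Y ⊗ X)) where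

    private
      -XY+YX≡0 : ∀ i j → - (X ⊗ Y) i j + (Y ⊗ X) i j ≡ 0ℤ
      -XY+YX≡0 i j = trans (cong (λ t → - t + (Y ⊗ X) i j) (XY≐YX i j)) (+-inverseˡ ((Y ⊗ X) i j))

      block : ∀ x z (i l : Fin n) →
              ∑[ y < 2 ] (quadrants X Y x y ⊗ transpose (quadrants X Y z y)) i l ≡ k * (δ x z * δ i l)
      block zero zero i l = begin
        (X ⊗ transpose X) i l + ((Y ⊗ transpose Y) i l + 0ℤ)  ≡⟨ cong (λ t → (X ⊗ transpose X) i l + t) (+-identityʳ _) ⟩
        (X ⊗ transpose X) i l + (Y ⊗ transpose Y) i l         ≡⟨ XXᵀ+YYᵀ≐kI i l ⟩
        k * δ i l                                             ≡⟨ cong (k *_) (sym (*-identityˡ (δ i l))) ⟩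
        k * (1ℤ * δ i l)                                      ∎
      block zero (suc zero) i l = begin
        (X ⊗ negM Y) i l + ((Y ⊗ X) i l + 0ℤ)   ≡⟨ cong₂ _+_ (⊗-negʳ X Y i l) (+-identityʳ _) ⟩
        - (X ⊗ Y) i l + (Y ⊗ X) i l             ≡⟨ -XY+YX≡0 i l ⟩
        0ℤ                                      ≡⟨ sym (trans (cong (k *_) (*-zeroˡ (δ i l))) (*-zeroʳ k)) ⟩
        k * (0ℤ * δ i l)                        ∎
      block (suc zero) zero i l = begin
        (negM (transpose Y) ⊗ transpose X) i l + ((transpose X ⊗ transpose Y) i l + 0ℤ)
          ≡⟨ cong₂ _+_ (⊗-negˡ (transpose Y) (transpose X) i l) (+-identityʳ _) ⟩
        - (transpose Y ⊗ transpose X) i l + (transpose X ⊗ transpose Y) i l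
          ≡⟨ cong₂ (λ s t → - s + t) (transpose-⊗ Y X i l) (transpose-⊗ X Y i l) ⟩
        - (X ⊗ Y) l i + (Y ⊗ X) l i             ≡⟨ -XY+YX≡0 l i ⟩
        0ℤ                                      ≡⟨ sym (trans (cong (k *_) (*-zeroˡ (δ i l))) (*-zeroʳ k)) ⟩
        k * (0ℤ * δ i l)                        ∎
      block (suc zero) (suc zero) i l = begin
        (negM (transpose Y) ⊗ negM Y) i l + ((transpose X ⊗ X) i l + 0ℤ)
          ≡⟨ cong₂ _+_ (trans (⊗-negˡ (transpose Y) (negM Y) i l) (cong -_ (⊗-negʳ (transpose Y) Y i l))) (+-identityʳ _) ⟩
        - - (transpose Y ⊗ Y) i l + (transpose X ⊗ X) i l
          ≡⟨ trans (cong (_+ (transpose X ⊗ X) i l) (neg-involutive ((transpose Y ⊗ Y) i l))) (+-comm ((transpose Y ⊗ Y) i l) ((transpose X ⊗ X) i l)) ⟩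
        (transpose X ⊗ X) i l + (transpose Y ⊗ Y) i l ≡⟨ XᵀX+YᵀY≐kI i l ⟩
        k * δ i l                                     ≡⟨ cong (k *_) (sym (*-identityˡ (δ i l))) ⟩
        k * (1ℤ * δ i l)                              ∎

    twoBlock-gram : (twoBlock X Y ⊗ transpose (twoBlock X Y)) ≐ (k · I)
    twoBlock-gram = ≐-combine λ x z i l → begin
      (twoBlock X Y ⊗ transpose (twoBlock X Y)) (combine x i) (combine z l)
        ≡⟨ blocks-⊗ (quadrants X Y) (λ y z → transpose (quadrants X Y z y)) x z i l ⟩
      ∑[ y < 2 ] (quadrants X Y x y ⊗ transpose (quadrants X Y z y)) i l ≡⟨ block x z i l ⟩
      k * (δ x z * δ i l)                                               ≡⟨ cong (k *_) (sym (δ-combine x z i l)) ⟩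
      k * δ (combine x i) (combine z l)                                 ∎

  module _ {n : ℕ} (U V : Matrix n) where

    ⊖⊕-gram : (((U ⊖ V) ⊗ transpose (U ⊖ V)) ⊕ ((U ⊕ V) ⊗ transpose (U ⊕ V)))
              ≐ ((+ 2) · ((U ⊗ transpose U) ⊕ (V ⊗ transpose V)))
    ⊖⊕-gram i j = begin
      ((U ⊖ V) ⊗ transpose (U ⊖ V)) i j + ((U ⊕ V) ⊗ transpose (U ⊕ V)) i j
        ≡⟨ cong₂ _+_ (⊗-sum (U ⊖ V) (transpose (U ⊖ V)) i j) (⊗-sum (U ⊕ V) (transpose (U ⊕ V)) i j) ⟩
      ∑[ k < n ] ((U i k - V i k) * (U j k - V j k)) + ∑[ k < n ] ((U i k + V i k) * (U j k + V j k))
        ≡⟨ sym (∑-distrib-+ (λ k → (U i k - V i k) * (U j k - V j k)) (λ k → (U i k + V i k) * (U j k + V j k))) ⟩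
      ∑[ k < n ] ((U i k - V i k) * (U j k - V j k) + (U i k + V i k) * (U j k + V j k))
        ≡⟨ sum-cong-≗ (λ k → parallelogram (U i k) (V i k) (U j k) (V j k)) ⟩
      ∑[ k < n ] (+ 2 * (U i k * U j k) + + 2 * (V i k * V j k))
        ≡⟨ ∑-linear (+ 2) (+ 2) (λ k → U i k * U j k) (λ k → V i k * V j k) ⟩
      + 2 * ∑[ k < n ] (U i k * U j k) + + 2 * ∑[ k < n ] (V i k * V j k)
        ≡⟨ sym (*-distribˡ-+ (+ 2) (∑[ k < n ] (U i k * U j k)) (∑[ k < n ] (V i k * V j k))) ⟩
      + 2 * (∑[ k < n ] (U i k * U j k) + ∑[ k < n ] (V i k * V j k))
        ≡⟨ cong (+ 2 *_) (sym (cong₂ _+_ (⊗-sum U (transpose U) i j) (⊗-sum V (transpose V) i j))) ⟩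
      + 2 * ((U ⊗ transpose U) i j + (V ⊗ transpose V) i j) ∎
      where
      parallelogram : ∀ a b c d → (a - b) * (c - d) + (a + b) * (c + d) ≡ + 2 * (a * c) + + 2 * (b * d)
      parallelogram = solve-∀

    ⊖⊕-comm : (U ⊗ V) ≐ (V ⊗ U) → ((U ⊖ V) ⊗ (U ⊕ V)) ≐ ((U ⊕ V) ⊗ (U ⊖ V))
    ⊖⊕-comm UV≐VU i j = begin
      ((U ⊖ V) ⊗ (U ⊕ V)) i j
        ≡⟨ ⊗-sum (U ⊖ V) (U ⊕ V) i j ⟩
      ∑[ k < n ] ((U i k - V i k) * (U k j + V k j))
        ≡⟨ sum-cong-≗ (λ k → swap-signs (U i k) (V i k) (U k j) (V k j)) ⟩
      ∑[ k < n ] (1ℤ * ((U i k + V i k) * (U k j - V k j)) + + 2 * (U i k * V k j - V i k * U k j))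
        ≡⟨ ∑-linear 1ℤ (+ 2) (λ k → (U i k + V i k) * (U k j - V k j)) (λ k → U i k * V k j - V i k * U k j) ⟩
      1ℤ * ∑[ k < n ] ((U i k + V i k) * (U k j - V k j)) + + 2 * ∑[ k < n ] (U i k * V k j - V i k * U k j)
        ≡⟨ cong₂ (λ s t → 1ℤ * s + + 2 * t) (sym (⊗-sum (U ⊕ V) (U ⊖ V) i j)) commutator≡0 ⟩
      1ℤ * ((U ⊕ V) ⊗ (U ⊖ V)) i j + + 2 * 0ℤ
        ≡⟨ 1*x+2*0≡x (((U ⊕ V) ⊗ (U ⊖ V)) i j) ⟩
      ((U ⊕ V) ⊗ (U ⊖ V)) i j ∎
      where
      swap-signs : ∀ a b c d → (a - b) * (c + d) ≡ 1ℤ * ((a + b) * (c - d)) + + 2 * (a * d - b * c)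
      swap-signs = solve-∀
      1*x+2*0≡x : ∀ x → 1ℤ * x + + 2 * 0ℤ ≡ x
      1*x+2*0≡x = solve-∀
      commutator≡0 : ∑[ k < n ] (U i k * V k j - V i k * U k j) ≡ 0ℤ
      commutator≡0 = begin
        ∑[ k < n ] (U i k * V k j - V i k * U k j)               ≡⟨ ∑-distrib-- (λ k → U i k * V k j) (λ k → V i k * U k j) ⟩
        ∑[ k < n ] (U i k * V k j) - ∑[ k < n ] (V i k * U k j)  ≡⟨ sym (cong₂ _-_ (⊗-sum U V i j) (⊗-sum V U i j)) ⟩
        (U ⊗ V) i j - (V ⊗ U) i j                                ≡⟨ cong (_- (V ⊗ U) i j) (UV≐VU i j) ⟩
        (V ⊗ U) i j - (V ⊗ U) i j                                ≡⟨ +-inverseʳ ((V ⊗ U) i j) ⟩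
        0ℤ                                                       ∎

  twoBlock-⊖⊕-gram : ∀ {n} (k : ℤ) (U V : Matrix n) →
    ((U ⊗ transpose U) ⊕ (V ⊗ transpose V)) ≐ (k · I) →
    ((transpose U ⊗ U) ⊕ (transpose V ⊗ V)) ≐ (k · I) →
    (U ⊗ V) ≐ (V ⊗ U) →
    (twoBlock (U ⊖ V) (U ⊕ V) ⊗ transpose (twoBlock (U ⊖ V) (U ⊕ V))) ≐ ((+ 2 * k) · I)
  twoBlock-⊖⊕-gram k U V UUᵀ+VVᵀ≐kI UᵀU+VᵀV≐kI UV≐VU =
    twoBlock-gram (+ 2 * k) (U ⊖ V) (U ⊕ V)
      (λ i j → trans (⊖⊕-gram U V i j) (doubled (UUᵀ+VVᵀ≐kI i j)))
      (λ i j → trans (⊖⊕-gram (transpose U) (transpose V) i j) (doubled (UᵀU+VᵀV≐kI i j)))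
      (⊖⊕-comm U V UV≐VU)
    where
    doubled : ∀ {x y} → x ≡ k * y → + 2 * x ≡ + 2 * k * y
    doubled {y = y} refl = sym (*-assoc (+ 2) k y)

  IsSign-resp : ∀ {x y} → x ≡ y → IsSign y → IsSign x
  IsSign-resp refl sign = sign

  IsSign-neg : ∀ {x} → IsSign x → IsSign (- x)
  IsSign-neg (inj₁ refl) = inj₂ refl
  IsSign-neg (inj₂ refl) = inj₁ refl

  IsSign-* : ∀ {x y} → IsSign x → IsSign y → IsSign (x * y)
  IsSign-* (inj₁ refl) (inj₁ refl) = inj₁ refl
  IsSign-* (inj₁ refl) (inj₂ refl) = inj₂ refl
  IsSign-* (inj₂ refl) (inj₁ refl) = inj₂ refl
  IsSign-* (inj₂ refl) (inj₂ refl) = inj₁ refl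

  twoBlock-sign : ∀ {n} {X Y : Matrix n} → (∀ i j → IsSign (X i j)) → (∀ i j → IsSign (Y i j)) →
                  ∀ a b → IsSign (twoBlock X Y a b)
  twoBlock-sign {n} {X} {Y} X± Y± a b = quadrant-sign (quotient n a) (quotient n b) (remainder {2} n a) (remainder {2} n b)
    where
    quadrant-sign : ∀ x y i j → IsSign (quadrants X Y x y i j)
    quadrant-sign zero       zero       i j = X± i j
    quadrant-sign zero       (suc zero) i j = Y± i j
    quadrant-sign (suc zero) zero       i j = IsSign-neg (Y± j i)
    quadrant-sign (suc zero) (suc zero) i j = X± j i

  module _ {n : ℕ} where

    transpose-shift : (A : Matrix n) (a : ℤ) → transpose (A ⊕ (a · I)) ≐ (transpose A ⊕ (a · I))
    transpose-shift A a i j = cong (λ d → A j i + a * d) (δ-sym j i)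

    ⊗-shift : (A B : Matrix n) (a b : ℤ) (i j : Fin n) →
              ((A ⊕ (a · I)) ⊗ (B ⊕ (b · I))) i j ≡ (A ⊗ B) i j + b * A i j + a * B i j + a * b * δ i j
    ⊗-shift A B a b i j = begin
      ((A ⊕ (a · I)) ⊗ (B ⊕ (b · I))) i j
        ≡⟨ ⊗-distribʳ-⊕ A (a · I) (B ⊕ (b · I)) i j ⟩
      (A ⊗ (B ⊕ (b · I))) i j + ((a · I) ⊗ (B ⊕ (b · I))) i j
        ≡⟨ cong₂ _+_ (⊗-distribˡ-⊕ A B (b · I) i j) (scalarI-⊗ a (B ⊕ (b · I)) i j) ⟩
      (A ⊗ B) i j + (A ⊗ (b · I)) i j + a * (B i j + b * δ i j)
        ≡⟨ cong (λ t → (A ⊗ B) i j + t + a * (B i j + b * δ i j)) (⊗-scalarI b A i j) ⟩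
      (A ⊗ B) i j + b * A i j + a * (B i j + b * δ i j)
        ≡⟨ expand ((A ⊗ B) i j) (A i j) (B i j) (δ i j) a b ⟩
      (A ⊗ B) i j + b * A i j + a * B i j + a * b * δ i j ∎
      where
      expand : ∀ p x y d a b → p + b * x + a * (y + b * d) ≡ p + b * x + a * y + a * b * d
      expand = solve-∀

    shift-comm : (A : Matrix n) (a b : ℤ) → ((A ⊕ (a · I)) ⊗ (A ⊕ (b · I))) ≐ ((A ⊕ (b · I)) ⊗ (A ⊕ (a · I)))
    shift-comm A a b i j = begin
      ((A ⊕ (a · I)) ⊗ (A ⊕ (b · I))) i j                     ≡⟨ ⊗-shift A A a b i j ⟩
      (A ⊗ A) i j + b * A i j + a * A i j + a * b * δ i j     ≡⟨ symmetric ((A ⊗ A) i j) (A i j) (δ i j) a b ⟩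
      (A ⊗ A) i j + a * A i j + b * A i j + b * a * δ i j     ≡⟨ sym (⊗-shift A A b a i j) ⟩
      ((A ⊕ (b · I)) ⊗ (A ⊕ (a · I))) i j                     ∎
      where
      symmetric : ∀ p x d a b → p + b * x + a * x + a * b * d ≡ p + a * x + b * x + b * a * d
      symmetric = solve-∀

    module _ (A : Matrix n) (A⊕Aᵀ≐2I : (A ⊕ transpose A) ≐ ((+ 2) · I)) where

      shift-⊕-transpose : (a : ℤ) → ((A ⊕ (a · I)) ⊕ transpose (A ⊕ (a · I))) ≐ ((+ 2 + + 2 * a) · I)
      shift-⊕-transpose a i j = begin
        (A i j + a * δ i j) + (A j i + a * δ j i)  ≡⟨ cong (λ d → (A i j + a * δ i j) + (A j i + a * d)) (δ-sym j i) ⟩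
        (A i j + a * δ i j) + (A j i + a * δ i j)  ≡⟨ regroup (A i j) (A j i) (a * δ i j) ⟩
        (A i j + A j i) + + 2 * (a * δ i j)        ≡⟨ cong (_+ + 2 * (a * δ i j)) (A⊕Aᵀ≐2I i j) ⟩
        + 2 * δ i j + + 2 * (a * δ i j)            ≡⟨ collect a (δ i j) ⟩
        (+ 2 + + 2 * a) * δ i j                    ∎
        where
        regroup : ∀ x y z → (x + z) + (y + z) ≡ (x + y) + + 2 * z
        regroup = solve-∀
        collect : ∀ a d → + 2 * d + + 2 * (a * d) ≡ (+ 2 + + 2 * a) * d
        collect = solve-∀

      shift-gram : (c : ℤ) → (A ⊗ transpose A) ≐ (c · I) → (a : ℤ) →
                   ((A ⊕ (a · I)) ⊗ transpose (A ⊕ (a · I))) ≐ ((c + + 2 * a + a * a) · I)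
      shift-gram c AAᵀ≐cI a i j = begin
        ((A ⊕ (a · I)) ⊗ transpose (A ⊕ (a · I))) i j
          ≡⟨ ⊗-congʳ (A ⊕ (a · I)) (transpose-shift A a) i j ⟩
        ((A ⊕ (a · I)) ⊗ (transpose A ⊕ (a · I))) i j
          ≡⟨ ⊗-shift A (transpose A) a a i j ⟩
        (A ⊗ transpose A) i j + a * A i j + a * A j i + a * a * δ i j
          ≡⟨ cong (λ t → t + a * A i j + a * A j i + a * a * δ i j) (AAᵀ≐cI i j) ⟩
        c * δ i j + a * A i j + a * A j i + a * a * δ i j
          ≡⟨ regroup c a (A i j) (A j i) (δ i j) ⟩
        c * δ i j + a * (A i j + A j i) + a * a * δ i j
          ≡⟨ cong (λ t → c * δ i j + a * t + a * a * δ i j) (A⊕Aᵀ≐2I i j) ⟩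
        c * δ i j + a * (+ 2 * δ i j) + a * a * δ i j
          ≡⟨ collect c a (δ i j) ⟩
        (c + + 2 * a + a * a) * δ i j ∎
        where
        regroup : ∀ c a x y d → c * d + a * x + a * y + a * a * d ≡ c * d + a * (x + y) + a * a * d
        regroup = solve-∀
        collect : ∀ c a d → c * d + a * (+ 2 * d) + a * a * d ≡ (c + + 2 * a + a * a) * d
        collect = solve-∀

  bordered : ∀ {q} → Matrix q → Matrix (suc q)
  bordered C zero    zero    = 0ℤ
  bordered C zero    (suc j) = 1ℤ
  bordered C (suc i) zero    = 1ℤ
  bordered C (suc i) (suc j) = C i j

  module _ {q : ℕ} (C : Matrix q) (CCᵀ≐qI-J : (C ⊗ transpose C) ≐ (((+ q) · I) ⊖ J)) (CJ≐0 : (C ⊗ J) ≐ (0ℤ · I)) where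

    private
      row-sum≡0 : ∀ i → sumFin q (λ k → C i k * 1ℤ) ≡ 0ℤ
      row-sum≡0 i = trans (CJ≐0 i i) (*-zeroˡ (δ i i))

      1+[x-1]≡x : ∀ x → 1ℤ + (x - 1ℤ) ≡ x
      1+[x-1]≡x = solve-∀

      border-entry : ∀ i → (bordered C ⊗ transpose (bordered C)) (suc i) zero ≡ + q * 0ℤ
      border-entry i = begin
        0ℤ + sumFin q (λ k → C i k * 1ℤ)  ≡⟨ +-identityˡ _ ⟩
        sumFin q (λ k → C i k * 1ℤ)       ≡⟨ row-sum≡0 i ⟩
        0ℤ                                ≡⟨ sym (*-zeroʳ (+ q)) ⟩
        + q * 0ℤ                          ∎

      bordered-gram : (bordered C ⊗ transpose (bordered C)) ≐ ((+ q) · I)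
      bordered-gram zero zero = begin
        0ℤ + sumFin q (λ _ → 1ℤ)  ≡⟨ +-identityˡ _ ⟩
        sumFin q (λ _ → 1ℤ)       ≡⟨ trans (sumFin≡sum q _) (∑-one q) ⟩
        + q                       ≡⟨ sym (*-identityʳ (+ q)) ⟩
        + q * 1ℤ                  ∎
      bordered-gram zero    (suc j) = trans (transpose-⊗ (transpose (bordered C)) (bordered C) zero (suc j)) (border-entry j)
      bordered-gram (suc i) zero    = border-entry i
      bordered-gram (suc i) (suc j) = trans (cong (λ t → 1ℤ + t) (CCᵀ≐qI-J i j)) (1+[x-1]≡x (+ q * δ i j))

    conference-transpose-gram : (transpose C ⊗ C) ≐ (((+ q) · I) ⊖ J)
    conference-transpose-gram i j = begin
      (transpose C ⊗ C) i j              ≡⟨ x≡[1+x]-1 ((transpose C ⊗ C) i j) ⟩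
      1ℤ + (transpose C ⊗ C) i j - 1ℤ    ≡⟨ cong (_- 1ℤ) (MMᵀ≐cI⇒MᵀM≐cI (+ q) (bordered C) bordered-gram (suc i) (suc j)) ⟩
      + q * δ i j - 1ℤ                   ∎
      where
      x≡[1+x]-1 : ∀ x → x ≡ 1ℤ + x - 1ℤ
      x≡[1+x]-1 = solve-∀

  x≡-x⇒x≡0 : ∀ {x} → x ≡ - x → x ≡ 0ℤ
  x≡-x⇒x≡0 {+ zero}   _  = refl
  x≡-x⇒x≡0 {+ suc n}  ()
  x≡-x⇒x≡0 { -[1+ n ]} ()

  module _ {m : ℕ} (H : Matrix m) (skew : SkewSymmetric (H ⊖ I)) where

    skew-diagonal≡1 : ∀ u → H u u ≡ 1ℤ
    skew-diagonal≡1 u = trans (i-j≡0⇒i≡j (H u u) (δ u u) (x≡-x⇒x≡0 (skew u u))) (δ-refl u)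

    skew⇒⊕-transpose≐2I : (H ⊕ transpose H) ≐ ((+ 2) · I)
    skew⇒⊕-transpose≐2I u v = begin
      H u v + H v u                              ≡⟨ regroup (H u v) (H v u) (δ u v) ⟩
      (H v u - δ u v) + (H u v - δ u v) + + 2 * δ u v
        ≡⟨ cong (λ t → (H v u - t) + (H u v - δ u v) + + 2 * δ u v) (δ-sym u v) ⟩
      (H v u - δ v u) + (H u v - δ u v) + + 2 * δ u v
        ≡⟨ cong (λ t → t + (H u v - δ u v) + + 2 * δ u v) (skew u v) ⟩
      - (H u v - δ u v) + (H u v - δ u v) + + 2 * δ u v
        ≡⟨ cong (_+ + 2 * δ u v) (+-inverseˡ (H u v - δ u v)) ⟩
      0ℤ + + 2 * δ u v                           ≡⟨ +-identityˡ _ ⟩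
      + 2 * δ u v                                ∎
      where
      regroup : ∀ x y d → x + y ≡ (y - d) + (x - d) + + 2 * d
      regroup = solve-∀

  -- The construction

  module Construction {q m : ℕ} (C : Matrix q) (H : Matrix m) where

    S Q : Matrix m
    S = H ⊕ (-1ℤ · I)
    Q = H ⊕ (1ℤ · I)

    U J⊠I I⊠Q V : Matrix (q ℕ.* m)
    U   = C ⊠ S
    J⊠I = J {q} ⊠ I
    I⊠Q = I {q} ⊠ Q
    V   = J⊠I ⊖ I⊠Q

    module _ (CCᵀ≐qI-J : (C ⊗ transpose C) ≐ (((+ q) · I) ⊖ J))
             (HHᵀ≐mI : (H ⊗ transpose H) ≐ ((+ m) · I))
             (H⊕Hᵀ≐2I : (H ⊕ transpose H) ≐ ((+ 2) · I)) where

      V⊗Vᵀ-combine : ∀ i j u v → (V ⊗ transpose V) (combine i u) (combine j v)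
                     ≡ (+ q * δ u v - 1ℤ * Q v u) - (1ℤ * Q u v - δ i j * ((+ m + + 2 * 1ℤ + 1ℤ * 1ℤ) * δ u v))
      V⊗Vᵀ-combine i j u v = begin
        (V ⊗ transpose V) x y
          ≡⟨ ⊗-distribʳ-⊖ J⊠I I⊠Q (transpose V) x y ⟩
        (J⊠I ⊗ transpose V) x y - (I⊠Q ⊗ transpose V) x y
          ≡⟨ cong₂ _-_ (⊗-distribˡ-⊖ J⊠I (transpose J⊠I) (transpose I⊠Q) x y) (⊗-distribˡ-⊖ I⊠Q (transpose J⊠I) (transpose I⊠Q) x y) ⟩
        ((J⊠I ⊗ transpose J⊠I) x y - (J⊠I ⊗ transpose I⊠Q) x y) - ((I⊠Q ⊗ transpose J⊠I) x y - (I⊠Q ⊗ transpose I⊠Q) x y)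
          ≡⟨ cong₂ _-_ (cong₂ _-_ (⊠-⊗-combine {q} {m} J J I (transpose I) i j u v) (⊠-⊗-combine {q} {m} J (transpose I) I (transpose Q) i j u v))
                       (cong₂ _-_ (⊠-⊗-combine {q} {m} I J Q (transpose I) i j u v) (⊠-⊗-combine {q} {m} I (transpose I) Q (transpose Q) i j u v)) ⟩
        ((J ⊗ J) i j * (I ⊗ transpose I) u v - (J ⊗ transpose I) i j * (I ⊗ transpose Q) u v)
          - ((I ⊗ J) i j * (Q ⊗ transpose I) u v - (I ⊗ transpose I) i j * (Q ⊗ transpose Q) u v)
          ≡⟨ cong₂ _-_ (cong₂ _-_ (cong₂ _*_ (J⊗J≡n i j) (trans (⊗-identityˡ (transpose I) u v) (δ-sym v u)))
                                  (cong₂ _*_ (⊗-transpose-I J i j) (⊗-identityˡ (transpose Q) u v)))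
                       (cong₂ _-_ (cong₂ _*_ (⊗-identityˡ J i j) (⊗-transpose-I Q u v))
                                  (cong₂ _*_ (trans (⊗-identityˡ (transpose I) i j) (δ-sym j i)) (shift-gram H H⊕Hᵀ≐2I (+ m) HHᵀ≐mI 1ℤ u v))) ⟩
        (+ q * δ u v - 1ℤ * Q v u) - (1ℤ * Q u v - δ i j * ((+ m + + 2 * 1ℤ + 1ℤ * 1ℤ) * δ u v)) ∎
        where
        x y : Fin (q ℕ.* m)
        x = combine i u
        y = combine j v

      UUᵀ+VVᵀ≐qmI : q ≡ m ℕ.+ 3 → ((U ⊗ transpose U) ⊕ (V ⊗ transpose V)) ≐ ((+ (q ℕ.* m)) · I)
      UUᵀ+VVᵀ≐qmI q≡m+3 = ≐-combine entry
        where
        q≡m+3ℤ : + q ≡ + m + + 3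
        q≡m+3ℤ = trans (cong +_ q≡m+3) (pos-+ m 3)

        entry : ∀ i j u v → ((U ⊗ transpose U) ⊕ (V ⊗ transpose V)) (combine i u) (combine j v)
                            ≡ + (q ℕ.* m) * δ (combine i u) (combine j v)
        entry i j u v = begin
          (U ⊗ transpose U) (combine i u) (combine j v) + (V ⊗ transpose V) (combine i u) (combine j v)
            ≡⟨ cong₂ _+_ (⊠-⊗-combine C (transpose C) S (transpose S) i j u v) (V⊗Vᵀ-combine i j u v) ⟩
          (C ⊗ transpose C) i j * (S ⊗ transpose S) u v
            + ((+ q * δ u v - 1ℤ * Q v u) - (1ℤ * Q u v - δ i j * ((+ m + + 2 * 1ℤ + 1ℤ * 1ℤ) * δ u v)))
            ≡⟨ cong (_+ ((+ q * δ u v - 1ℤ * Q v u) - (1ℤ * Q u v - δ i j * ((+ m + + 2 * 1ℤ + 1ℤ * 1ℤ) * δ u v))))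
                    (cong₂ _*_ (CCᵀ≐qI-J i j) (shift-gram H H⊕Hᵀ≐2I (+ m) HHᵀ≐mI -1ℤ u v)) ⟩
          (+ q * δ i j - 1ℤ) * ((+ m + + 2 * -1ℤ + -1ℤ * -1ℤ) * δ u v)
            + ((+ q * δ u v - 1ℤ * Q v u) - (1ℤ * Q u v - δ i j * ((+ m + + 2 * 1ℤ + 1ℤ * 1ℤ) * δ u v)))
            ≡⟨ collect (+ m) (δ i j) (δ u v) (Q u v) (Q v u) q≡m+3ℤ (shift-⊕-transpose H H⊕Hᵀ≐2I 1ℤ u v) ⟩
          + q * + m * (δ i j * δ u v)
            ≡⟨ cong₂ _*_ (sym (pos-* q m)) (sym (δ-combine i j u v)) ⟩
          + (q ℕ.* m) * δ (combine i u) (combine j v) ∎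
          where
          -- The terms in e alone, i.e. the J ⊠ I part, have coefficient q′ − m′ − 3.
          collect : ∀ {q′} m′ d e x y → q′ ≡ m′ + + 3 → x + y ≡ (+ 2 + + 2 * 1ℤ) * e →
                    (q′ * d - 1ℤ) * ((m′ + + 2 * -1ℤ + -1ℤ * -1ℤ) * e)
                      + ((q′ * e - 1ℤ * y) - (1ℤ * x - d * ((m′ + + 2 * 1ℤ + 1ℤ * 1ℤ) * e)))
                    ≡ q′ * m′ * (d * e)
          collect m′ d e x y refl x+y≡4e = begin
            ((m′ + + 3) * d - 1ℤ) * ((m′ + + 2 * -1ℤ + -1ℤ * -1ℤ) * e)
              + (((m′ + + 3) * e - 1ℤ * y) - (1ℤ * x - d * ((m′ + + 2 * 1ℤ + 1ℤ * 1ℤ) * e)))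
              ≡⟨ expand m′ d e x y ⟩
            (m′ + + 3) * m′ * (d * e) + ((+ 2 + + 2 * 1ℤ) * e - (x + y))
              ≡⟨ cong (λ t → (m′ + + 3) * m′ * (d * e) + ((+ 2 + + 2 * 1ℤ) * e - t)) x+y≡4e ⟩
            (m′ + + 3) * m′ * (d * e) + ((+ 2 + + 2 * 1ℤ) * e - (+ 2 + + 2 * 1ℤ) * e)
              ≡⟨ cancel ((m′ + + 3) * m′ * (d * e)) ((+ 2 + + 2 * 1ℤ) * e) ⟩
            (m′ + + 3) * m′ * (d * e) ∎
            where
            expand : ∀ m′ d e x y →
                     ((m′ + + 3) * d - 1ℤ) * ((m′ + + 2 * -1ℤ + -1ℤ * -1ℤ) * e)
                       + (((m′ + + 3) * e - 1ℤ * y) - (1ℤ * x - d * ((m′ + + 2 * 1ℤ + 1ℤ * 1ℤ) * e)))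
                     ≡ (m′ + + 3) * m′ * (d * e) + ((+ 2 + + 2 * 1ℤ) * e - (x + y))
            expand = solve-∀
            cancel : ∀ r k → r + (k - k) ≡ r
            cancel = solve-∀

    module _ (CJ≐0 : (C ⊗ J) ≐ (0ℤ · I)) (JC≐0 : (J ⊗ C) ≐ (0ℤ · I)) where

      private
        annihilates : ∀ {Z : Matrix q} → Z ≐ (0ℤ · I) → ∀ i j x → Z i j * x ≡ 0ℤ
        annihilates {Z} Z≐0 i j x = trans (cong (_* x) (trans (Z≐0 i j) (*-zeroˡ (δ i j)))) (*-zeroˡ x)

        U⊗V-combine : ∀ i j u v → (U ⊗ V) (combine i u) (combine j v) ≡ 0ℤ - C i j * (S ⊗ Q) u v
        U⊗V-combine i j u v = begin
          (U ⊗ V) (combine i u) (combine j v)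
            ≡⟨ ⊗-distribˡ-⊖ U J⊠I I⊠Q (combine i u) (combine j v) ⟩
          (U ⊗ J⊠I) (combine i u) (combine j v) - (U ⊗ I⊠Q) (combine i u) (combine j v)
            ≡⟨ cong₂ _-_ (⊠-⊗-combine C J S I i j u v) (⊠-⊗-combine C I S Q i j u v) ⟩
          (C ⊗ J) i j * (S ⊗ I) u v - (C ⊗ I) i j * (S ⊗ Q) u v
            ≡⟨ cong₂ _-_ (annihilates CJ≐0 i j ((S ⊗ I) u v)) (cong (_* (S ⊗ Q) u v) (⊗-identityʳ C i j)) ⟩
          0ℤ - C i j * (S ⊗ Q) u v ∎

        V⊗U-combine : ∀ i j u v → (V ⊗ U) (combine i u) (combine j v) ≡ 0ℤ - C i j * (Q ⊗ S) u v
        V⊗U-combine i j u v = begin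
          (V ⊗ U) (combine i u) (combine j v)
            ≡⟨ ⊗-distribʳ-⊖ J⊠I I⊠Q U (combine i u) (combine j v) ⟩
          (J⊠I ⊗ U) (combine i u) (combine j v) - (I⊠Q ⊗ U) (combine i u) (combine j v)
            ≡⟨ cong₂ _-_ (⊠-⊗-combine J C I S i j u v) (⊠-⊗-combine I C Q S i j u v) ⟩
          (J ⊗ C) i j * (I ⊗ S) u v - (I ⊗ C) i j * (Q ⊗ S) u v
            ≡⟨ cong₂ _-_ (annihilates JC≐0 i j ((I ⊗ S) u v)) (cong (_* (Q ⊗ S) u v) (⊗-identityˡ C i j)) ⟩
          0ℤ - C i j * (Q ⊗ S) u v ∎

      U⊗V≐V⊗U : (U ⊗ V) ≐ (V ⊗ U)
      U⊗V≐V⊗U = ≐-combine λ i j u v → begin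
        (U ⊗ V) (combine i u) (combine j v)  ≡⟨ U⊗V-combine i j u v ⟩
        0ℤ - C i j * (S ⊗ Q) u v             ≡⟨ cong (λ t → 0ℤ - C i j * t) (shift-comm H -1ℤ 1ℤ u v) ⟩
        0ℤ - C i j * (Q ⊗ S) u v             ≡⟨ sym (V⊗U-combine i j u v) ⟩
        (V ⊗ U) (combine i u) (combine j v)  ∎

    module _ (C-diag : ∀ i → C i i ≡ 0ℤ) (C-sign : ∀ i j → ¬ i ≡ j → IsSign (C i j))
             (H-sign : ∀ u v → IsSign (H u v)) (H-diag : ∀ u → H u u ≡ 1ℤ) where

      private
        entry-sign : ∀ {ε} → IsSign ε → ∀ i j u v → IsSign (C i j * S u v + ε * (1ℤ * δ u v - δ i j * Q u v))
        entry-sign {ε} ε± i j u v with i ≟ j | u ≟ v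
        ... | yes refl | _ = IsSign-resp (same-block (C-diag i) (δ-refl i)) (IsSign-neg (IsSign-* ε± (H-sign u v)))
          where
          same-block : ∀ {c e} → c ≡ 0ℤ → e ≡ 1ℤ →
                       c * (H u v + -1ℤ * δ u v) + ε * (1ℤ * δ u v - e * (H u v + 1ℤ * δ u v)) ≡ - (ε * H u v)
          same-block refl refl = ring (H u v) (δ u v) ε
            where
            ring : ∀ h d ε → 0ℤ * (h + -1ℤ * d) + ε * (1ℤ * d - 1ℤ * (h + 1ℤ * d)) ≡ - (ε * h)
            ring = solve-∀
        ... | no i≢j | yes refl = IsSign-resp (diagonal-entry (H-diag u) (δ-refl u) (δ-≢ i≢j)) ε±
          where
          diagonal-entry : ∀ {h d e} → h ≡ 1ℤ → d ≡ 1ℤ → e ≡ 0ℤ →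
                           C i j * (h + -1ℤ * d) + ε * (1ℤ * d - e * (h + 1ℤ * d)) ≡ ε
          diagonal-entry refl refl refl = ring (C i j) ε
            where
            ring : ∀ c ε → c * (1ℤ + -1ℤ * 1ℤ) + ε * (1ℤ * 1ℤ - 0ℤ * (1ℤ + 1ℤ * 1ℤ)) ≡ ε
            ring = solve-∀
        ... | no i≢j | no u≢v = IsSign-resp (generic-entry (δ-≢ u≢v) (δ-≢ i≢j)) (IsSign-* (C-sign i j i≢j) (H-sign u v))
          where
          generic-entry : ∀ {d e} → d ≡ 0ℤ → e ≡ 0ℤ →
                          C i j * (H u v + -1ℤ * d) + ε * (1ℤ * d - e * (H u v + 1ℤ * d)) ≡ C i j * H u v
          generic-entry refl refl = ring (C i j) (H u v) ε
            where
            ring : ∀ c h ε → c * (h + -1ℤ * 0ℤ) + ε * (1ℤ * 0ℤ - 0ℤ * (h + 1ℤ * 0ℤ)) ≡ c * h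
            ring = solve-∀

      U⊖V-sign : ∀ a b → IsSign ((U ⊖ V) a b)
      U⊖V-sign a b = IsSign-resp (x-y≡x+-1y (U a b) (V a b))
        (entry-sign (inj₂ refl) (quotient m a) (quotient m b) (remainder {q} m a) (remainder {q} m b))
        where
        x-y≡x+-1y : ∀ x y → x - y ≡ x + -1ℤ * y
        x-y≡x+-1y = solve-∀

      U⊕V-sign : ∀ a b → IsSign ((U ⊕ V) a b)
      U⊕V-sign a b = IsSign-resp (cong (λ t → U a b + t) (sym (*-identityˡ (V a b))))
        (entry-sign (inj₁ refl) (quotient m a) (quotient m b) (remainder {q} m a) (remainder {q} m b))

  module _ {q m : ℕ} (C : Matrix q) (H : Matrix m) where

    private
      module K  = Construction C H
      module Kᵀ = Construction (transpose C) (transpose H)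

    transpose-U : transpose K.U ≐ Kᵀ.U
    transpose-U a b = cong (C (quotient m b) (quotient m a) *_) (transpose-shift H -1ℤ (remainder {q} m a) (remainder {q} m b))

    transpose-V : transpose K.V ≐ Kᵀ.V
    transpose-V a b = cong₂ (λ d e → 1ℤ * d - e * (H u′ u + 1ℤ * d)) (δ-sym u′ u) (δ-sym i′ i)
      where
      i i′ : Fin q
      i  = quotient m a
      i′ = quotient m b
      u u′ : Fin m
      u  = remainder {q} m a
      u′ = remainder {q} m b

    skew-conference⇒hadamard : q ≡ m ℕ.+ 3 → IsSkewHadamard m H → IsConference q C →
                               IsHadamard (2 ℕ.* (q ℕ.* m)) (twoBlock (K.U ⊖ K.V) (K.U ⊕ K.V))
    skew-conference⇒hadamard q≡m+3 ((H± , HHᵀ≐mI , HᵀH≐mI) , skew) (C-diag , C± , CCᵀ≐qI-J , CJ≐0 , JC≐0) =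
      G± , GGᵀ≐NI , MMᵀ≐cI⇒MᵀM≐cI (+ N) G GGᵀ≐NI
      where
      N : ℕ
      N = 2 ℕ.* (q ℕ.* m)

      G : Matrix N
      G = twoBlock (K.U ⊖ K.V) (K.U ⊕ K.V)

      H⊕Hᵀ≐2I : (H ⊕ transpose H) ≐ ((+ 2) · I)
      H⊕Hᵀ≐2I = skew⇒⊕-transpose≐2I H skew

      Hᵀ⊕H≐2I : (transpose H ⊕ H) ≐ ((+ 2) · I)
      Hᵀ⊕H≐2I u v = trans (+-comm (H v u) (H u v)) (H⊕Hᵀ≐2I u v)

      -- (Cᵀ, Hᵀ) satisfy the hypotheses on (C, H), and the matrices they produce are Uᵀ and Vᵀ.
      UᵀU+VᵀV≐qmI : ((transpose K.U ⊗ K.U) ⊕ (transpose K.V ⊗ K.V)) ≐ ((+ (q ℕ.* m)) · I)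
      UᵀU+VᵀV≐qmI a b = begin
        (transpose K.U ⊗ K.U) a b + (transpose K.V ⊗ K.V) a b
          ≡⟨ cong₂ _+_ (⊗-cong transpose-U (λ x y → transpose-U y x) a b) (⊗-cong transpose-V (λ x y → transpose-V y x) a b) ⟩
        (Kᵀ.U ⊗ transpose Kᵀ.U) a b + (Kᵀ.V ⊗ transpose Kᵀ.V) a b
          ≡⟨ Kᵀ.UUᵀ+VVᵀ≐qmI (conference-transpose-gram C CCᵀ≐qI-J CJ≐0) HᵀH≐mI Hᵀ⊕H≐2I q≡m+3 a b ⟩
        + (q ℕ.* m) * I a b ∎

      G± : ∀ a b → IsSign (G a b)
      G± = twoBlock-sign (K.U⊖V-sign C-diag C± H± (skew-diagonal≡1 H skew))
                         (K.U⊕V-sign C-diag C± H± (skew-diagonal≡1 H skew))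

      GGᵀ≐NI : (G ⊗ transpose G) ≐ ((+ N) · I)
      GGᵀ≐NI a b = trans
        (twoBlock-⊖⊕-gram (+ (q ℕ.* m)) K.U K.V (K.UUᵀ+VVᵀ≐qmI CCᵀ≐qI-J HHᵀ≐mI H⊕Hᵀ≐2I q≡m+3) UᵀU+VᵀV≐qmI
          (K.U⊗V≐V⊗U CJ≐0 JC≐0) a b)
        (cong (_* I a b) (sym (pos-* 2 (q ℕ.* m))))

open import Data.Nat using (ℕ; _+_; _*_; _%_; _≤_)
import Data.Nat.Properties as ℕ
open import Data.Product using (Σ; _,_)
open import Relation.Binary.PropositionalEquality using (_≡_; sym; trans; subst)

theorem3p4 : (s q : ℕ) → 1 ≤ s → 1 ≤ q → q ≡ s + 4 → s % 4 ≡ 3 →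
    Σ (Matrix (s + 1)) (IsSkewHadamard (s + 1)) →
    Σ (Matrix q) (IsConference q) →
    Σ (Matrix (2 * q * (s + 1))) (IsHadamard (2 * q * (s + 1)))
theorem3p4 s q _ _ q≡s+4 _ (H , skewHadamard) (C , conference) =
  subst (λ N → Σ (Matrix N) (IsHadamard N)) (sym (ℕ.*-assoc 2 q (s + 1)))
    (_ , skew-conference⇒hadamard C H q≡[s+1]+3 skewHadamard conference)
  where
  q≡[s+1]+3 : q ≡ s + 1 + 3
  q≡[s+1]+3 = trans q≡s+4 (sym (ℕ.+-assoc s 1 3))
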